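{- Let $\mathbb{K}$ be a field of characteristic $0$ and $F(X,Y)=f_n(X)Y^n+\dots+f_0(X)\in\mathbb{K}[X,Y]$ a polynomial of $Y$-degree $n$ such that $F(0,Y)$ is not identically $0$. Suppose that $\mathbb{L}$ is a finite extension of $\mathbb{K}$, $e_1,\dots,e_n$ are positive integers and $y_i\in\mathbb{L}((x^{1/e_i}))$ are series with $$F(x,Y)=f_n(x)(Y-y_1)\cdots(Y-y_n),$$ written as $y_i=\sum_{k=\kappa_i}^\infty a_{ik}x^{k/e_i}$ with $a_{i\kappa_i}\neq0$. Let $$r=\min\Big\{i+j:\ \frac{\partial^{i+j}F}{\partial^iX\,\partial^jY}(0,0)\neq 0\Big\}.$$ Then $$r=\sum_{i:\ \kappa_i>0}\min\{1,\kappa_i/e_i\},$$ the sum being over those $i$ with $\kappa_i>0$. -}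

module Defs where

open import Level using (Level; _⊔_) renaming (suc to lsuc)
open import Data.Nat as ℕ using (ℕ; zero; suc; NonZero; _≤_)
open import Data.Nat.Divisibility using (_∣_; _∣?_; quotient)
import Data.Nat.DivMod as DM
open import Data.Integer as ℤ using (ℤ; +_; -[1+_])
import Data.Integer.Properties as ℤP
open import Data.Rational as ℚ using (ℚ; 0ℚ; 1ℚ)
open import Data.Fin using (Fin; fromℕ; fromℕ<)
import Data.Fin as Fin
open import Data.List using (List; []; _∷_; map)
open import Data.Product using (Σ; ∃; _×_; _,_)
open import Relation.Nullary using (¬_; Dec; yes; no)
open import Relation.Binary.PropositionalEquality using (_≡_)
open import Algebra.Bundles using (CommutativeRing)
open import Algebra.Morphism.Structures using (IsRingHomomorphism)

record Field (c ℓ : Level) : Set (lsuc (c ⊔ ℓ)) where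
  field
    commutativeRing : CommutativeRing c ℓ
  open CommutativeRing commutativeRing public
  field
    0≉1     : ¬ (0# ≈ 1#)
    inverse : ∀ x → ¬ (x ≈ 0#) → ∃ λ y → (x * y) ≈ 1#

module RingStuff {c ℓ} (R : CommutativeRing c ℓ) where
  open CommutativeRing R

  _·ₙ_ : ℕ → Carrier → Carrier
  zero  ·ₙ a = 0#
  suc m ·ₙ a = a + (m ·ₙ a)

  sumTo : ℕ → (ℕ → Carrier) → Carrier
  sumTo zero    g = 0#
  sumTo (suc n) g = sumTo n g + g n

  sumFin : (d : ℕ) → (Fin d → Carrier) → Carrier
  sumFin zero    g = 0#
  sumFin (suc d) g = g Fin.zero + sumFin d (λ k → g (Fin.suc k))

  coeffList : List Carrier → ℕ → Carrier
  coeffList []       k       = 0#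
  coeffList (a ∷ p)  zero    = a
  coeffList (a ∷ p)  (suc k) = coeffList p k

  -- spread m c : the sequence j ↦ c (j/m) if m ∣ j, else 0
  -- (substitution t ↦ t^m in a power series with coefficients c)
  spreadD : (c : ℕ → Carrier) {m j : ℕ} → Dec (m ∣ j) → Carrier
  spreadD c (yes p) = c (quotient p)
  spreadD c (no _)  = 0#

  spread : ℕ → (ℕ → Carrier) → ℕ → Carrier
  spread m c j = spreadD c (m ∣? j)

  -- Formal Laurent series  Σ_{k ≥ 0} co k · t^(ord + k)  over R

  record LS : Set c where
    constructor mkLS
    field
      ord : ℤ
      co  : ℕ → Carrier
  open LS public

  coeffAtD : LS → ℤ → Carrier
  coeffAtD s (+ k)      = co s k
  coeffAtD s -[1+ _ ]   = 0#

  coeffAt : LS → ℤ → Carrier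
  coeffAt s n = coeffAtD s (n ℤ.- ord s)

  _≈ˢ_ : LS → LS → Set ℓ
  s ≈ˢ s′ = ∀ n → coeffAt s n ≈ coeffAt s′ n

  zeroˢ : LS
  zeroˢ = mkLS (+ 0) (λ _ → 0#)

  constˢ : Carrier → LS
  constˢ a = mkLS (+ 0) (λ { zero → a ; (suc _) → 0# })

  oneˢ : LS
  oneˢ = constˢ 1#

  _+ˢ_ : LS → LS → LS
  s +ˢ s′ = mkLS o (λ k → coeffAt s (o ℤ.+ + k) + coeffAt s′ (o ℤ.+ + k))
    where o = ord s ℤ.⊓ ord s′

  _*ˢ_ : LS → LS → LS
  s *ˢ s′ = mkLS (ord s ℤ.+ ord s′)
                 (λ k → sumTo (suc k) (λ i → co s i * co s′ (k ℕ.∸ i)))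

  -ˢ_ : LS → LS
  -ˢ s = mkLS (ord s) (λ k → - co s k)

  -- Polynomials in Y over Laurent series (coefficient lists, lowest first)

  Poly : Set c
  Poly = List LS

  pcoeff : Poly → ℕ → LS
  pcoeff []      j       = zeroˢ
  pcoeff (a ∷ p) zero    = a
  pcoeff (a ∷ p) (suc j) = pcoeff p j

  _≈ᵖ_ : Poly → Poly → Set ℓ
  P ≈ᵖ Q = ∀ j → pcoeff P j ≈ˢ pcoeff Q j

  _+ᵖ_ : Poly → Poly → Poly
  []      +ᵖ q       = q
  (a ∷ p) +ᵖ []      = a ∷ p
  (a ∷ p) +ᵖ (b ∷ q) = (a +ˢ b) ∷ (p +ᵖ q)

  _·ᵖ_ : LS → Poly → Poly
  a ·ᵖ p = map (a *ˢ_) p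

  _*ᵖ_ : Poly → Poly → Poly
  []      *ᵖ q = []
  (a ∷ p) *ᵖ q = (a ·ᵖ q) +ᵖ (zeroˢ ∷ (p *ᵖ q))

  Y-_ : LS → Poly
  Y- y = (-ˢ y) ∷ oneˢ ∷ []

  prodFin : (n : ℕ) → (Fin n → Poly) → Poly
  prodFin zero    g = oneˢ ∷ []
  prodFin (suc n) g = g Fin.zero *ᵖ prodFin n (λ i → g (Fin.suc i))

module _ {a ℓa} (K : Field a ℓa) where
  private module K = Field K

  CharZero : Set ℓa
  CharZero = ∀ m → ¬ (RingStuff._·ₙ_ K.commutativeRing (suc m) K.1# K.≈ K.0#)

  -- A bivariate polynomial F = Σ_{j ≤ n} f_j(X) Y^j is given by
  -- f : Fin (suc n) → List K  (f j = coefficient list of f_j in X).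
  -- Fcoef n f i j = coefficient of X^i Y^j in F.
  FcoefD : (n : ℕ) → (Fin (suc n) → List K.Carrier) → ℕ → {j : ℕ} →
           Dec (j ℕ.< suc n) → K.Carrier
  FcoefD n f i (yes p) = RingStuff.coeffList K.commutativeRing (f (fromℕ< p)) i
  FcoefD n f i (no _)  = K.0#

  Fcoef : (n : ℕ) → (Fin (suc n) → List K.Carrier) → ℕ → ℕ → K.Carrier
  Fcoef n f i j = FcoefD n f i (j ℕ.<? suc n)

  YDegree : (n : ℕ) → (Fin (suc n) → List K.Carrier) → Set ℓa
  YDegree n f = ∃ λ k → ¬ (RingStuff.coeffList K.commutativeRing (f (fromℕ n)) k K.≈ K.0#)

  F0YNonzero : (n : ℕ) → (Fin (suc n) → List K.Carrier) → Set ℓa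
  F0YNonzero n f = ∃ λ j → ¬ (Fcoef n f 0 j K.≈ K.0#)

  -- formal partial derivatives of a bivariate series given by its
  -- coefficient function (i ↦ X-exponent, j ↦ Y-exponent)
  ∂X : (ℕ → ℕ → K.Carrier) → (ℕ → ℕ → K.Carrier)
  ∂X G i j = RingStuff._·ₙ_ K.commutativeRing (suc i) (G (suc i) j)

  ∂Y : (ℕ → ℕ → K.Carrier) → (ℕ → ℕ → K.Carrier)
  ∂Y G i j = RingStuff._·ₙ_ K.commutativeRing (suc j) (G i (suc j))

  iter : {A : Set a} → ℕ → (A → A) → A → A
  iter zero    h x = x
  iter (suc m) h x = h (iter m h x)

  derivAt00 : (n : ℕ) → (Fin (suc n) → List K.Carrier) → ℕ → ℕ → K.Carrier
  derivAt00 n f i j = iter i ∂X (iter j ∂Y (Fcoef n f)) 0 0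

  IsMinDerivOrder : (n : ℕ) → (Fin (suc n) → List K.Carrier) → ℕ → Set ℓa
  IsMinDerivOrder n f r =
    (∃ λ i → ∃ λ j → (i ℕ.+ j ≡ r) × ¬ (derivAt00 n f i j K.≈ K.0#)) ×
    (∀ i j → ¬ (derivAt00 n f i j K.≈ K.0#) → r ≤ i ℕ.+ j)

module _ {a ℓa b ℓb} (K : Field a ℓa) (L : Field b ℓb) where
  private
    module K = Field K
    module L = Field L

  IsFieldHom : (K.Carrier → L.Carrier) → Set (a ⊔ ℓa ⊔ ℓb)
  IsFieldHom φ = IsRingHomomorphism (CommutativeRing.rawRing K.commutativeRing)
                                    (CommutativeRing.rawRing L.commutativeRing) φ

  FiniteOver : (K.Carrier → L.Carrier) → Set (a ⊔ b ⊔ ℓb)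
  FiniteOver φ = ∃ λ d → Σ (Fin d → L.Carrier) λ β → ∀ x →
    ∃ λ (γ : Fin d → K.Carrier) →
      x L.≈ RingStuff.sumFin L.commutativeRing d (λ k → φ (γ k) L.* β k)

  private open module LR = RingStuff L.commutativeRing

  -- product of the e_i : a common denominator E, with x = t^E
  prodℕ : (n : ℕ) → (Fin n → ℕ) → ℕ
  prodℕ zero    e = 1
  prodℕ (suc n) e = e Fin.zero ℕ.* prodℕ n (λ i → e (Fin.suc i))

  -- the Puiseux series Σ_k β k · x^((κ+k)/e)  written in t = x^(1/E),
  -- where e ∣ E:  Σ_k β k · t^((κ+k)·(E/e))
  puiseux : (E e : ℕ) → .{{NonZero e}} → ℤ → (ℕ → L.Carrier) → LS
  puiseux E e κ β = mkLS (κ ℤ.* + m) (spread m β)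
    where m = E DM./ e

  -- a polynomial p(X) ∈ K[X], mapped to L and evaluated at x = t^E
  liftX : (E : ℕ) → (K.Carrier → L.Carrier) → List K.Carrier → LS
  liftX E φ p = mkLS (+ 0) (spread E (λ k → φ (RingStuff.coeffList K.commutativeRing p k)))

  FasPolyY : (E : ℕ) → (K.Carrier → L.Carrier) → (n : ℕ) →
             (Fin (suc n) → List K.Carrier) → Poly
  FasPolyY E φ n f = go (suc n) f
    where
    go : (m : ℕ) → (Fin m → List K.Carrier) → Poly
    go zero    g = []
    go (suc m) g = liftX E φ (g Fin.zero) ∷ go m (λ i → g (Fin.suc i))

  FactorsAs : (K.Carrier → L.Carrier) → (n : ℕ) →
              (f : Fin (suc n) → List K.Carrier) →
              (e : Fin n → ℕ) → (∀ i → NonZero (e i)) →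
              (κ : Fin n → ℤ) → (β : Fin n → ℕ → L.Carrier) → Set ℓb
  FactorsAs φ n f e epos κ β =
    FasPolyY E φ n f ≈ᵖ
      (liftX E φ (f (fromℕ n)) ·ᵖ
        prodFin n (λ i → Y- puiseux E (e i) {{epos i}} (κ i) (β i)))
    where E = prodℕ n e

sumℚ : (n : ℕ) → (Fin n → ℚ) → ℚ
sumℚ zero    g = 0ℚ
sumℚ (suc n) g = g Fin.zero ℚ.+ sumℚ n (λ i → g (Fin.suc i))

termD : (κ : ℤ) (e : ℕ) → .{{NonZero e}} → Dec (+ 0 ℤ.< κ) → ℚ
termD κ e (yes _) = 1ℚ ℚ.⊓ (κ ℚ./ e)
termD κ e (no _)  = 0ℚ

puiseuxSum : (n : ℕ) → (e : Fin n → ℕ) → (∀ i → NonZero (e i)) → (Fin n → ℤ) → ℚ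
puiseuxSum n e epos κ = sumℚ n (λ i → termD (κ i) (e i) {{epos i}} (+ 0 ℤP.<? κ i))

-- Put x = t^E with E = ∏ eᵢ.  Then F(t^E, Y) = fₙ(t^E) ∏ (Y − yᵢ) in L((t))[Y], and yᵢ has t-order
-- κᵢ E/eᵢ.  Give t^a Y^j the weight a + jW.  Initial terms (least weight, ties broken by the Y-degree)
-- multiply, so the W-order of the right-hand side is ord fₙ(t^E) + Σ min(ord yᵢ, W).  On the left,
-- X^i Y^j has weight (i + j)E for W = E; in characteristic 0 the coefficient of X^i Y^j vanishes
-- exactly when the corresponding derivative at (0,0) does, so the E-order is E r.  For W = 0 the
-- order is 0 since F(0,Y) ≠ 0.  Subtracting the two equations cancels ord fₙ(t^E) and leaves
-- E r = Σ (min(ord yᵢ, E) − min(ord yᵢ, 0)), that is r = Σ_{κᵢ>0} min(1, κᵢ/eᵢ).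
-- Coefficient equality in an arbitrary field is not decidable, so vanishing is used in double-negated
-- form ("weakly zero"); this costs nothing because the final equation lives in ℚ, where it is decidable.

module Submission where

open import Defs
open import Data.Nat using (ℕ; suc; NonZero)
open import Data.Integer using (ℤ; +_)
open import Data.Rational using (_/_)
open import Data.Fin using (Fin)
open import Data.List using (List)
open import Relation.Nullary using (¬_)
open import Relation.Binary.PropositionalEquality using (_≡_)

open import Level using (0ℓ)
open import Data.Nat as ℕ using (zero)
import Data.Nat.Properties as ℕP
open import Data.Nat.Induction using (<-rec)
open import Data.Nat.Divisibility using (_∣_; divides; _∣?_; m∣m*n; n∣m*n; ∣-trans)
open import Data.Nat.DivMod using (m/n*n≡m)
open import Data.Integer as ℤ using (-[1+_])
import Data.Integer.Properties as ℤP
open import Data.Integer.Tactic.RingSolver using (solve-∀)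
open import Data.Rational as ℚ using (ℚ)
import Data.Rational.Properties as ℚP
import Data.Rational.Unnormalised as ℚᵘ
import Data.Rational.Unnormalised.Properties as ℚᵘP
import Data.Fin as Fin
open import Data.List using ([]; _∷_)
open import Data.Product using (∃; _×_; _,_; proj₁; proj₂)
open import Data.Product.Relation.Binary.Lex.Strict using (×-Lex)
open import Data.Sum using (_⊎_; inj₁; inj₂)
open import Data.Empty using (⊥-elim)
open import Relation.Nullary using (yes; no)
open import Relation.Nullary.Decidable using (decidable-stable)
open import Relation.Binary.Core using (Rel)
open import Relation.Binary.Definitions using (tri<; tri≈; tri>)
open import Relation.Binary.PropositionalEquality
  using (_≢_; refl; sym; trans; cong; cong₂; subst; subst₂; module ≡-Reasoning)
import Relation.Binary.Reasoning.Setoid as ≈-Reasoning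
open import Algebra.Bundles using (CommutativeRing; AbelianGroup)
open import Algebra.Morphism.Structures using (IsRingHomomorphism)
import Algebra.Properties.Ring as RingProperties
open import Algebra.Properties.Group (AbelianGroup.group ℤP.+-0-abelianGroup)
  using () renaming (∙-cancelˡ to +-cancelˡ-≡)
open import Algebra.Properties.CommutativeSemigroup ℤP.+-commutativeSemigroup
  using () renaming (interchange to +-interchange)
open import Algebra.Properties.Monoid.Sum ℤP.+-0-monoid using (sum)

≥-view : ∀ (x o : ℤ) → x ℤ.< o ⊎ ∃ λ k → x ≡ o ℤ.+ + k
≥-view x o with o ℤP.≤? x
... | no o≰x  = inj₁ (ℤP.≰⇒> o≰x)
... | yes o≤x = inj₂ (ℤ.∣ x ℤ.- o ∣ , sym (trans (cong (λ w → o ℤ.+ w) ∣x-o∣≡x-o) (o+[x-o]≡x o x)))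
  where
  ∣x-o∣≡x-o : + ℤ.∣ x ℤ.- o ∣ ≡ x ℤ.- o
  ∣x-o∣≡x-o = ℤP.0≤i⇒+∣i∣≡i (ℤP.i≤j⇒0≤j-i o≤x)
  o+[x-o]≡x : ∀ o x → o ℤ.+ (x ℤ.- o) ≡ x
  o+[x-o]≡x = solve-∀

<-suc : ∀ x → x ℤ.< ℤ.suc x
<-suc x = ℤP.suc[i]≤j⇒i<j ℤP.≤-refl

+-cancelˡ-< : ∀ a {b c} → a ℤ.+ b ℤ.< a ℤ.+ c → b ℤ.< c
+-cancelˡ-< a {b} {c} lt = subst₂ ℤ._<_ (cancel a b) (cancel a c) (ℤP.+-monoʳ-< (ℤ.- a) lt)
  where
  cancel : ∀ a b → ℤ.- a ℤ.+ (a ℤ.+ b) ≡ b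
  cancel = solve-∀

+-cancelˡ-≤ : ∀ a {b c} → a ℤ.+ b ℤ.≤ a ℤ.+ c → b ℤ.≤ c
+-cancelˡ-≤ a {b} {c} le = subst₂ ℤ._≤_ (cancel a b) (cancel a c) (ℤP.+-monoʳ-≤ (ℤ.- a) le)
  where
  cancel : ∀ a b → ℤ.- a ℤ.+ (a ℤ.+ b) ≡ b
  cancel = solve-∀

module Vanishing {c ℓ} (R : CommutativeRing c ℓ) where
  open CommutativeRing R hiding (zero)
    renaming (refl to ≈-refl; sym to ≈-sym; trans to ≈-trans)
  open RingStuff R
  open RingProperties ring using (-0#≈0#)

  Nonzero : Carrier → Set ℓ
  Nonzero x = ¬ x ≈ 0#

  WeaklyZero : Carrier → Set ℓ
  WeaklyZero x = ¬ Nonzero x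

  ≈0⇒weaklyZero : ∀ {x} → x ≈ 0# → WeaklyZero x
  ≈0⇒weaklyZero x≈0 x≉0 = x≉0 x≈0

  weaklyZero-resp : ∀ {x y} → x ≈ y → WeaklyZero x → WeaklyZero y
  weaklyZero-resp x≈y wx y≉0 = wx (λ x≈0 → y≉0 (≈-trans (≈-sym x≈y) x≈0))

  nonzero-resp : ∀ {x y} → x ≈ y → Nonzero x → Nonzero y
  nonzero-resp x≈y x≉0 y≈0 = x≉0 (≈-trans x≈y y≈0)

  weaklyZero-*ˡ : ∀ {x} y → WeaklyZero x → WeaklyZero (x * y)
  weaklyZero-*ˡ y wx xy≉0 = wx (λ x≈0 → xy≉0 (≈-trans (*-congʳ x≈0) (zeroˡ y)))

  weaklyZero-*ʳ : ∀ x {y} → WeaklyZero y → WeaklyZero (x * y)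
  weaklyZero-*ʳ x wy xy≉0 = wy (λ y≈0 → xy≉0 (≈-trans (*-congˡ y≈0) (zeroʳ x)))

  weaklyZero-+ : ∀ {x y} → WeaklyZero x → WeaklyZero y → WeaklyZero (x + y)
  weaklyZero-+ wx wy x+y≉0 = wx λ x≈0 → wy λ y≈0 → x+y≉0 (≈-trans (+-cong x≈0 y≈0) (+-identityˡ 0#))

  nonzero-+ʳ : ∀ {x y} → Nonzero x → WeaklyZero y → Nonzero (x + y)
  nonzero-+ʳ {x} x≉0 wy x+y≈0 =
    wy λ y≈0 → x≉0 (≈-trans (≈-sym (+-identityʳ x)) (≈-trans (+-congˡ (≈-sym y≈0)) x+y≈0))

  nonzero-+ˡ : ∀ {x y} → WeaklyZero x → Nonzero y → Nonzero (x + y)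
  nonzero-+ˡ {x} {y} wx y≉0 x+y≈0 = nonzero-+ʳ y≉0 wx (≈-trans (+-comm y x) x+y≈0)

  nonzero-neg : ∀ {x} → Nonzero x → Nonzero (- x)
  nonzero-neg {x} x≉0 -x≈0 =
    x≉0 (≈-trans (≈-sym (+-identityʳ x)) (≈-trans (+-congˡ (≈-sym -x≈0)) (-‿inverseʳ x)))

  sumTo-weaklyZero : ∀ k g → (∀ i → i ℕ.< k → WeaklyZero (g i)) → WeaklyZero (sumTo k g)
  sumTo-weaklyZero zero    g wg = ≈0⇒weaklyZero ≈-refl
  sumTo-weaklyZero (suc k) g wg =
    weaklyZero-+ (sumTo-weaklyZero k g (λ i i<k → wg i (ℕP.m<n⇒m<1+n i<k))) (wg k ℕP.≤-refl)

  sumTo-nonzero : ∀ k g {p} → p ℕ.< k → (∀ i → i ℕ.< k → i ≢ p → WeaklyZero (g i)) →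
                  Nonzero (g p) → Nonzero (sumTo k g)
  sumTo-nonzero (suc k) g {p} p<1+k wg gp≉0 with p ℕ.≟ k
  ... | yes refl = nonzero-+ˡ (sumTo-weaklyZero k g (λ i i<k → wg i (ℕP.m<n⇒m<1+n i<k) (ℕP.<⇒≢ i<k))) gp≉0
  ... | no p≢k   = nonzero-+ʳ
    (sumTo-nonzero k g (ℕP.≤∧≢⇒< (ℕP.≤-pred p<1+k) p≢k) (λ i i<k → wg i (ℕP.m<n⇒m<1+n i<k)) gp≉0)
    (wg k ℕP.≤-refl (λ k≡p → p≢k (sym k≡p)))

  IsLeastNonzero : (ℕ → Carrier) → ℕ → Set ℓ
  IsLeastNonzero c d = Nonzero (c d) × (∀ i → i ℕ.< d → WeaklyZero (c i))

  ¬¬least-nonzero : (c : ℕ → Carrier) → ∀ k → Nonzero (c k) → ¬ ¬ ∃ (IsLeastNonzero c)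
  ¬¬least-nonzero c = <-rec _ λ k below ck≉0 ¬least →
    ¬least (k , ck≉0 , λ i i<k ci≉0 → below i<k ci≉0 ¬least)

  coeffAtD-negative : ∀ s z → z ℤ.< + 0 → coeffAtD s z ≡ 0#
  coeffAtD-negative s (+ _)      (ℤ.+<+ ())
  coeffAtD-negative s -[1+ _ ] _ = refl

  coeffAt-<ord : ∀ s {x} → x ℤ.< ord s → coeffAt s x ≡ 0#
  coeffAt-<ord s {x} x<o = coeffAtD-negative s (x ℤ.- ord s)
    (subst (x ℤ.- ord s ℤ.<_) (ℤP.+-inverseʳ (ord s)) (ℤP.+-monoˡ-< (ℤ.- ord s) x<o))

  coeffAt-ord+ : ∀ s {x} k → x ≡ ord s ℤ.+ + k → coeffAt s x ≡ co s k
  coeffAt-ord+ s k refl = cong (coeffAtD s) (cancel (ord s) (+ k))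
    where
    cancel : ∀ o x → (o ℤ.+ x) ℤ.- o ≡ x
    cancel = solve-∀

  coeffAt-zeroˢ : ∀ x → coeffAt zeroˢ x ≈ 0#
  coeffAt-zeroˢ x with x ℤ.- + 0
  ... | + _      = ≈-refl
  ... | -[1+ _ ] = ≈-refl

  coeffAt-oneˢ : ∀ {x} → x ≢ + 0 → coeffAt oneˢ x ≈ 0#
  coeffAt-oneˢ {x} x≢0 with ≥-view x (+ 0)
  ... | inj₁ x<0           = reflexive (coeffAt-<ord oneˢ x<0)
  ... | inj₂ (zero  , x≡0) = ⊥-elim (x≢0 x≡0)
  ... | inj₂ (suc k , x≡k) = reflexive (coeffAt-ord+ oneˢ (suc k) x≡k)

  coeffAt-+ˢ : ∀ s s′ x → coeffAt (s +ˢ s′) x ≈ coeffAt s x + coeffAt s′ x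
  coeffAt-+ˢ s s′ x with ≥-view x (ord s ℤ.⊓ ord s′)
  ... | inj₁ x<o = ≈-trans (reflexive (coeffAt-<ord (s +ˢ s′) x<o)) (≈-sym (≈-trans
        (+-cong (reflexive (coeffAt-<ord s (ℤP.<-≤-trans x<o (ℤP.i⊓j≤i _ _))))
                (reflexive (coeffAt-<ord s′ (ℤP.<-≤-trans x<o (ℤP.i⊓j≤j _ _)))))
        (+-identityˡ 0#)))
  ... | inj₂ (k , x≡o+k) = reflexive
        (trans (coeffAt-ord+ (s +ˢ s′) k x≡o+k) (cong (λ z → coeffAt s z + coeffAt s′ z) (sym x≡o+k)))

  coeffAt--ˢ : ∀ s x → coeffAt (-ˢ s) x ≈ - coeffAt s x
  coeffAt--ˢ s x with ≥-view x (ord s)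
  ... | inj₁ x<o = ≈-trans (reflexive (coeffAt-<ord (-ˢ s) x<o))
                     (≈-trans (≈-sym -0#≈0#) (-‿cong (reflexive (sym (coeffAt-<ord s x<o)))))
  ... | inj₂ (k , x≡o+k) = reflexive
        (trans (coeffAt-ord+ (-ˢ s) k x≡o+k) (cong -_ (sym (coeffAt-ord+ s k x≡o+k))))

  convolution-exponent : ∀ s s′ {i k} → i ℕ.≤ k →
    (ord s ℤ.+ + i) ℤ.+ (ord s′ ℤ.+ + (k ℕ.∸ i)) ≡ (ord s ℤ.+ ord s′) ℤ.+ + k
  convolution-exponent s s′ {i} {k} i≤k =
    trans (+-interchange (ord s) (+ i) (ord s′) (+ (k ℕ.∸ i)))
          (cong (λ w → (ord s ℤ.+ ord s′) ℤ.+ + w) (ℕP.m+[n∸m]≡n i≤k))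

  convolution-term-weaklyZero : ∀ s s′ i j →
    WeaklyZero (coeffAt s (ord s ℤ.+ + i)) ⊎ WeaklyZero (coeffAt s′ (ord s′ ℤ.+ + j)) →
    WeaklyZero (co s i * co s′ j)
  convolution-term-weaklyZero s s′ i j (inj₁ w) =
    weaklyZero-*ˡ _ (subst WeaklyZero (coeffAt-ord+ s i refl) w)
  convolution-term-weaklyZero s s′ i j (inj₂ w) =
    weaklyZero-*ʳ _ (subst WeaklyZero (coeffAt-ord+ s′ j refl) w)

  coeffAt-*ˢ-weaklyZero : ∀ s s′ x →
    (∀ x₁ x₂ → x₁ ℤ.+ x₂ ≡ x → WeaklyZero (coeffAt s x₁) ⊎ WeaklyZero (coeffAt s′ x₂)) →
    WeaklyZero (coeffAt (s *ˢ s′) x)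
  coeffAt-*ˢ-weaklyZero s s′ x split with ≥-view x (ord s ℤ.+ ord s′)
  ... | inj₁ x<o = ≈0⇒weaklyZero (reflexive (coeffAt-<ord (s *ˢ s′) x<o))
  ... | inj₂ (k , x≡o+k) = weaklyZero-resp (reflexive (sym (coeffAt-ord+ (s *ˢ s′) k x≡o+k)))
    (sumTo-weaklyZero (suc k) _ λ i i≤k → convolution-term-weaklyZero s s′ i (k ℕ.∸ i)
      (split (ord s ℤ.+ + i) (ord s′ ℤ.+ + (k ℕ.∸ i))
             (trans (convolution-exponent s s′ (ℕP.≤-pred i≤k)) (sym x≡o+k))))

  OrderAtLeast : LS → ℤ → Set ℓ
  OrderAtLeast s m = ∀ x → x ℤ.< m → WeaklyZero (coeffAt s x)

  coeffAt-+ᵖ : ∀ P Q j x →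
    coeffAt (pcoeff (P +ᵖ Q) j) x ≈ coeffAt (pcoeff P j) x + coeffAt (pcoeff Q j) x
  coeffAt-+ᵖ []      Q       j       x = ≈-sym (≈-trans (+-congʳ (coeffAt-zeroˢ x)) (+-identityˡ _))
  coeffAt-+ᵖ (a ∷ P) []      j       x = ≈-sym (≈-trans (+-congˡ (coeffAt-zeroˢ x)) (+-identityʳ _))
  coeffAt-+ᵖ (a ∷ P) (b ∷ Q) zero    x = coeffAt-+ˢ a b x
  coeffAt-+ᵖ (a ∷ P) (b ∷ Q) (suc j) x = coeffAt-+ᵖ P Q j x

  ·ᵖ-weaklyZero : ∀ a Q j x → WeaklyZero (coeffAt (a *ˢ pcoeff Q j) x) →
                  WeaklyZero (coeffAt (pcoeff (a ·ᵖ Q) j) x)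
  ·ᵖ-weaklyZero a []      j       x w = ≈0⇒weaklyZero (coeffAt-zeroˢ x)
  ·ᵖ-weaklyZero a (q ∷ Q) zero    x w = w
  ·ᵖ-weaklyZero a (q ∷ Q) (suc j) x w = ·ᵖ-weaklyZero a Q j x w

  ·ᵖ-nonzero : ∀ a Q j x → Nonzero (coeffAt (a *ˢ pcoeff Q j) x) →
               Nonzero (coeffAt (pcoeff (a ·ᵖ Q) j) x)
  ·ᵖ-nonzero a []      j       x nz _ =
    coeffAt-*ˢ-weaklyZero a zeroˢ x (λ _ x₂ _ → inj₂ (≈0⇒weaklyZero (coeffAt-zeroˢ x₂))) nz
  ·ᵖ-nonzero a (q ∷ Q) zero    x nz = nz
  ·ᵖ-nonzero a (q ∷ Q) (suc j) x nz = ·ᵖ-nonzero a Q j x nz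

  spread-* : ∀ m {{_ : NonZero m}} (c : ℕ → Carrier) q → spread m c (q ℕ.* m) ≡ c q
  spread-* m c q with m ∣? q ℕ.* m
  ... | yes (divides q′ eq) = cong c (sym (ℕP.*-cancelʳ-≡ q q′ m eq))
  ... | no ∤ = ⊥-elim (∤ (divides q refl))

  spread-weaklyZero : ∀ m (c : ℕ → Carrier) k → (∀ q → k ≡ q ℕ.* m → WeaklyZero (c q)) →
                      WeaklyZero (spread m c k)
  spread-weaklyZero m c k wc with m ∣? k
  ... | yes (divides q k≡qm) = wc q k≡qm
  ... | no _                 = ≈0⇒weaklyZero ≈-refl

module FieldVanishing {c ℓ} (F : Field c ℓ) where
  open Field F hiding (zero)
    renaming (refl to ≈-refl; sym to ≈-sym; trans to ≈-trans)
  open RingStuff commutativeRing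
  open Vanishing commutativeRing public

  nonzero-1 : Nonzero 1#
  nonzero-1 1≈0 = 0≉1 (≈-sym 1≈0)

  nonzero-* : ∀ {x y} → Nonzero x → Nonzero y → Nonzero (x * y)
  nonzero-* {x} {y} x≉0 y≉0 xy≈0 with inverse x x≉0
  ... | x⁻¹ , xx⁻¹≈1 = y≉0 (begin
    y              ≈⟨ ≈-sym (*-identityˡ y) ⟩
    1# * y         ≈⟨ *-congʳ (≈-trans (≈-sym xx⁻¹≈1) (*-comm x x⁻¹)) ⟩
    (x⁻¹ * x) * y  ≈⟨ *-assoc x⁻¹ x y ⟩
    x⁻¹ * (x * y)  ≈⟨ *-congˡ xy≈0 ⟩
    x⁻¹ * 0#       ≈⟨ zeroʳ x⁻¹ ⟩
    0#             ∎)
    where open ≈-Reasoning setoid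

  coeffAt-*ˢ-nonzero : ∀ s s′ x x′ →
    (∀ x₁ x₂ → x₁ ℤ.+ x₂ ≡ x ℤ.+ x′ → x₁ ≢ x →
       WeaklyZero (coeffAt s x₁) ⊎ WeaklyZero (coeffAt s′ x₂)) →
    Nonzero (coeffAt s x) → Nonzero (coeffAt s′ x′) → Nonzero (coeffAt (s *ˢ s′) (x ℤ.+ x′))
  coeffAt-*ˢ-nonzero s s′ x x′ split nz nz′ with ≥-view x (ord s) | ≥-view x′ (ord s′)
  ... | inj₁ x<o | _         = λ _ → nz (reflexive (coeffAt-<ord s x<o))
  ... | inj₂ _   | inj₁ x′<o = λ _ → nz′ (reflexive (coeffAt-<ord s′ x′<o))
  ... | inj₂ (p , x≡o+p) | inj₂ (p′ , x′≡o+p′) =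
    nonzero-resp (reflexive (sym (coeffAt-ord+ (s *ˢ s′) (p ℕ.+ p′) exponent)))
      (sumTo-nonzero (suc (p ℕ.+ p′)) _ (ℕ.s≤s (ℕP.m≤m+n p p′)) others leading)
    where
    exponent : x ℤ.+ x′ ≡ (ord s ℤ.+ ord s′) ℤ.+ + (p ℕ.+ p′)
    exponent = trans (cong₂ ℤ._+_ x≡o+p x′≡o+p′) (+-interchange (ord s) (+ p) (ord s′) (+ p′))
    leading : Nonzero (co s p * co s′ ((p ℕ.+ p′) ℕ.∸ p))
    leading = subst (λ z → Nonzero (co s p * co s′ z)) (sym (ℕP.m+n∸m≡n p p′))
      (nonzero-* (subst Nonzero (coeffAt-ord+ s p x≡o+p) nz) (subst Nonzero (coeffAt-ord+ s′ p′ x′≡o+p′) nz′))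
    others : ∀ i → i ℕ.< suc (p ℕ.+ p′) → i ≢ p → WeaklyZero (co s i * co s′ ((p ℕ.+ p′) ℕ.∸ i))
    others i i≤p+p′ i≢p = convolution-term-weaklyZero s s′ i _
      (split _ _ (trans (convolution-exponent s s′ (ℕP.≤-pred i≤p+p′)) (sym exponent))
        (λ eq → i≢p (ℤP.+-injective (+-cancelˡ-≡ (ord s) (+ i) (+ p) (trans eq x≡o+p)))))

module Weighted {c ℓ} (F : Field c ℓ) (W : ℤ) where
  open Field F hiding (zero)
    renaming (refl to ≈-refl; sym to ≈-sym; trans to ≈-trans)
  open RingStuff commutativeRing
  open FieldVanishing F

  weight : ℤ → ℕ → ℤ
  weight x j = x ℤ.+ + j ℤ.* W

  _≺_ : Rel (ℤ × ℕ) 0ℓ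
  _≺_ = ×-Lex _≡_ ℤ._<_ ℕ._<_

  VanishesBelow : Poly → ℤ → ℕ → Set ℓ
  VanishesBelow P C c = ∀ j x → (weight x j , j) ≺ (C , c) → WeaklyZero (coeffAt (pcoeff P j) x)

  NonzeroAt : Poly → ℤ → ℕ → Set ℓ
  NonzeroAt P C c = Nonzero (coeffAt (pcoeff P c) (C ℤ.- + c ℤ.* W))

  InitialTerm : Poly → ℤ → ℕ → Set ℓ
  InitialTerm P C c = VanishesBelow P C c × NonzeroAt P C c

  HasOrder : Poly → ℤ → Set ℓ
  HasOrder P C = VanishesBelow P C 0 × ∃ (NonzeroAt P C)

  weight-zero : ∀ x → weight x 0 ≡ x
  weight-zero x = x+0W≡x x W
    where
    x+0W≡x : ∀ x W → x ℤ.+ + 0 ℤ.* W ≡ x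
    x+0W≡x = solve-∀

  weight-suc : ∀ x j → weight x (suc j) ≡ W ℤ.+ weight x j
  weight-suc x j = x+[1+j]W≡W+[x+jW] x (+ j) W
    where
    x+[1+j]W≡W+[x+jW] : ∀ x j W → x ℤ.+ (+ 1 ℤ.+ j) ℤ.* W ≡ W ℤ.+ (x ℤ.+ j ℤ.* W)
    x+[1+j]W≡W+[x+jW] = solve-∀

  weight-+ : ∀ x₁ x₂ j → weight (x₁ ℤ.+ x₂) j ≡ x₁ ℤ.+ weight x₂ j
  weight-+ x₁ x₂ j = ℤP.+-assoc x₁ x₂ (+ j ℤ.* W)

  weight-split : ∀ x₁ x₂ {x} j → x₁ ℤ.+ x₂ ≡ x → weight x j ≡ x₁ ℤ.+ weight x₂ j
  weight-split x₁ x₂ j refl = weight-+ x₁ x₂ j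

  weight-position : ∀ C c → weight (C ℤ.- + c ℤ.* W) c ≡ C
  weight-position C c = [C-w]+w≡C C (+ c ℤ.* W)
    where
    [C-w]+w≡C : ∀ C w → (C ℤ.- w) ℤ.+ w ≡ C
    [C-w]+w≡C = solve-∀

  ≺-cancelˡ : ∀ a {u v j k} → (a ℤ.+ u , j) ≺ (a ℤ.+ v , k) → (u , j) ≺ (v , k)
  ≺-cancelˡ a (inj₁ lt)         = inj₁ (+-cancelˡ-< a lt)
  ≺-cancelˡ a (inj₂ (eq , j<k)) = inj₂ (+-cancelˡ-≡ a _ _ eq , j<k)

  ≺-cancelˡ-≤ : ∀ {a a′ u v j k} → a ℤ.≤ a′ → (a′ ℤ.+ u , j) ≺ (a ℤ.+ v , k) → (u , j) ≺ (v , k)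
  ≺-cancelˡ-≤ {a} {a′} {u} a≤a′ (inj₁ lt) =
    inj₁ (+-cancelˡ-< a (ℤP.≤-<-trans (ℤP.+-monoˡ-≤ u a≤a′) lt))
  ≺-cancelˡ-≤ {a} {a′} {u} {v} a≤a′ (inj₂ (eq , j<k)) with u ℤP.≟ v
  ... | yes u≡v = inj₂ (u≡v , j<k)
  ... | no u≢v  =
    inj₁ (ℤP.≤∧≢⇒< (+-cancelˡ-≤ a (subst (a ℤ.+ u ℤ.≤_) eq (ℤP.+-monoˡ-≤ u a≤a′))) u≢v)

  vanishesBelow-≤index : ∀ P {C c c′} → c′ ℕ.≤ c → VanishesBelow P C c → VanishesBelow P C c′
  vanishesBelow-≤index P c′≤c vb j x (inj₁ lt)         = vb j x (inj₁ lt)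
  vanishesBelow-≤index P c′≤c vb j x (inj₂ (eq , j<c′)) = vb j x (inj₂ (eq , ℕP.<-≤-trans j<c′ c′≤c))

  vanishesBelow-suc-weight : ∀ P {C c c′} → VanishesBelow P (ℤ.suc C) c → VanishesBelow P C c′
  vanishesBelow-suc-weight P {C} vb j x lt = vb j x (inj₁ (below lt))
    where
    below : ∀ {w k} → (w , j) ≺ (C , k) → w ℤ.< ℤ.suc C
    below (inj₁ w<C)        = ℤP.<-trans w<C (<-suc C)
    below (inj₂ (refl , _)) = <-suc C

  vanishesBelow-+ᵖ : ∀ P Q {C c} → VanishesBelow P C c → VanishesBelow Q C c → VanishesBelow (P +ᵖ Q) C c
  vanishesBelow-+ᵖ P Q vbP vbQ j x lt =
    weaklyZero-resp (≈-sym (coeffAt-+ᵖ P Q j x)) (weaklyZero-+ (vbP j x lt) (vbQ j x lt))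

  vanishesBelow-shift : ∀ R {C c} → VanishesBelow R C c → VanishesBelow (zeroˢ ∷ R) (W ℤ.+ C) (suc c)
  vanishesBelow-shift R vb zero    x _  = ≈0⇒weaklyZero (coeffAt-zeroˢ x)
  vanishesBelow-shift R vb (suc j) x lt
    with ≺-cancelˡ W (subst (λ w → (w , suc j) ≺ _) (weight-suc x j) lt)
  ... | inj₁ lt′            = vb j x (inj₁ lt′)
  ... | inj₂ (eq , 1+j<1+c) = vb j x (inj₂ (eq , ℕ.s<s⁻¹ 1+j<1+c))

  vanishesBelow-tail : ∀ p P {A a} → VanishesBelow (p ∷ P) A a → VanishesBelow P (A ℤ.- W) (ℕ.pred a)
  vanishesBelow-tail p P {A} {a} vb j x lt =
    vb (suc j) x (subst₂ (λ w C → (w , suc j) ≺ (C , a)) (sym (weight-suc x j)) (W+[A-W]≡A W A) (step a lt))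
    where
    W+[A-W]≡A : ∀ W A → W ℤ.+ (A ℤ.- W) ≡ A
    W+[A-W]≡A = solve-∀
    step : ∀ a → (weight x j , j) ≺ (A ℤ.- W , ℕ.pred a) →
           (W ℤ.+ weight x j , suc j) ≺ (W ℤ.+ (A ℤ.- W) , a)
    step a       (inj₁ lt′)        = inj₁ (ℤP.+-monoʳ-< W lt′)
    step (suc a) (inj₂ (eq , j<a)) = inj₂ (cong (λ w → W ℤ.+ w) eq , ℕ.s≤s j<a)

  vanishesBelow-head : ∀ p P {A a} → VanishesBelow (p ∷ P) A a → OrderAtLeast p A
  vanishesBelow-head p P {A} vb x x<A = vb zero x (inj₁ (subst (ℤ._< A) (sym (weight-zero x)) x<A))

  vanishesBelow-head-suc : ∀ p P {A a} → VanishesBelow (p ∷ P) A (suc a) → OrderAtLeast p (ℤ.suc A)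
  vanishesBelow-head-suc p P {A} vb x x<1+A with ℤP.<-cmp x A
  ... | tri< x<A _ _ = vanishesBelow-head p P vb x x<A
  ... | tri≈ _ x≡A _ = vb zero x (inj₂ (trans (weight-zero x) x≡A , ℕ.s≤s ℕ.z≤n))
  ... | tri> _ _ A<x = ⊥-elim (ℤP.<⇒≱ x<1+A (ℤP.i<j⇒suc[i]≤j A<x))

  vanishesBelow-·ᵖ : ∀ s Q {m B b} → OrderAtLeast s m → VanishesBelow Q B b →
                     VanishesBelow (s ·ᵖ Q) (m ℤ.+ B) b
  vanishesBelow-·ᵖ s Q {m} oa vb j x lt =
    ·ᵖ-weaklyZero s Q j x (coeffAt-*ˢ-weaklyZero s (pcoeff Q j) x split)
    where
    split : ∀ x₁ x₂ → x₁ ℤ.+ x₂ ≡ x → WeaklyZero (coeffAt s x₁) ⊎ WeaklyZero (coeffAt (pcoeff Q j) x₂)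
    split x₁ x₂ e with x₁ ℤP.<? m
    ... | yes x₁<m = inj₁ (oa x₁ x₁<m)
    ... | no x₁≮m  = inj₂ (vb j x₂
          (≺-cancelˡ-≤ (ℤP.≮⇒≥ x₁≮m) (subst (λ w → (w , j) ≺ _) (weight-split x₁ x₂ j e) lt)))

  nonzeroAt-·ᵖ : ∀ s Q {m B b} → OrderAtLeast s m → Nonzero (coeffAt s m) →
                 VanishesBelow Q B b → NonzeroAt Q B b → NonzeroAt (s ·ᵖ Q) (m ℤ.+ B) b
  nonzeroAt-·ᵖ s Q {m} {B} {b} oa nz vb nzQ =
    ·ᵖ-nonzero s Q b ((m ℤ.+ B) ℤ.- + b ℤ.* W) (subst (λ z → Nonzero (coeffAt (s *ˢ pcoeff Q b) z))
      (sym (ℤP.+-assoc m B (ℤ.- (+ b ℤ.* W))))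
      (coeffAt-*ˢ-nonzero s (pcoeff Q b) m (B ℤ.- + b ℤ.* W) split nz nzQ))
    where
    split : ∀ x₁ x₂ → x₁ ℤ.+ x₂ ≡ m ℤ.+ (B ℤ.- + b ℤ.* W) → x₁ ≢ m →
            WeaklyZero (coeffAt s x₁) ⊎ WeaklyZero (coeffAt (pcoeff Q b) x₂)
    split x₁ x₂ e x₁≢m with x₁ ℤP.<? m
    ... | yes x₁<m = inj₁ (oa x₁ x₁<m)
    ... | no x₁≮m  = inj₂ (vb b x₂ (inj₁ (+-cancelˡ-< m
          (ℤP.<-≤-trans (ℤP.+-monoˡ-< (weight x₂ b) m<x₁) (ℤP.≤-reflexive total)))))
      where
      m<x₁ = ℤP.≤∧≢⇒< (ℤP.≮⇒≥ x₁≮m) (λ m≡x₁ → x₁≢m (sym m≡x₁))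
      total : x₁ ℤ.+ weight x₂ b ≡ m ℤ.+ B
      total = trans (sym (weight-split x₁ x₂ b e))
        (trans (weight-+ m (B ℤ.- + b ℤ.* W) b) (cong (λ w → m ℤ.+ w) (weight-position B b)))

  module _ (Q : Poly) {B : ℤ} {b : ℕ} (vbQ : VanishesBelow Q B b) where

    vanishesBelow-*ᵖ : ∀ P {A a} → VanishesBelow P A a → VanishesBelow (P *ᵖ Q) (A ℤ.+ B) (a ℕ.+ b)
    vanishesBelow-shifted-*ᵖ : ∀ p P {A a} → VanishesBelow (p ∷ P) A a →
      VanishesBelow (zeroˢ ∷ (P *ᵖ Q)) (A ℤ.+ B) (suc (ℕ.pred a ℕ.+ b))

    vanishesBelow-*ᵖ []      vb j x _ = ≈0⇒weaklyZero (coeffAt-zeroˢ x)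
    vanishesBelow-*ᵖ (p ∷ P) {A} {zero} vb = vanishesBelow-+ᵖ (p ·ᵖ Q) (zeroˢ ∷ (P *ᵖ Q))
      (vanishesBelow-·ᵖ p Q (vanishesBelow-head p P vb) vbQ)
      (vanishesBelow-≤index (zeroˢ ∷ (P *ᵖ Q)) (ℕP.n≤1+n b) (vanishesBelow-shifted-*ᵖ p P vb))
    vanishesBelow-*ᵖ (p ∷ P) {A} {suc a} vb = vanishesBelow-+ᵖ (p ·ᵖ Q) (zeroˢ ∷ (P *ᵖ Q))
      (vanishesBelow-suc-weight (p ·ᵖ Q)
        (subst (λ C → VanishesBelow (p ·ᵖ Q) C b) (ℤP.+-assoc (+ 1) A B)
          (vanishesBelow-·ᵖ p Q (vanishesBelow-head-suc p P vb) vbQ)))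
      (vanishesBelow-shifted-*ᵖ p P vb)

    vanishesBelow-shifted-*ᵖ p P {A} {a} vb =
      subst (λ C → VanishesBelow (zeroˢ ∷ (P *ᵖ Q)) C (suc (ℕ.pred a ℕ.+ b))) (W+[[A-W]+B]≡A+B W A B)
        (vanishesBelow-shift (P *ᵖ Q) (vanishesBelow-*ᵖ P (vanishesBelow-tail p P vb)))
      where
      W+[[A-W]+B]≡A+B : ∀ W A B → W ℤ.+ ((A ℤ.- W) ℤ.+ B) ≡ A ℤ.+ B
      W+[[A-W]+B]≡A+B = solve-∀

    nonzeroAt-*ᵖ : ∀ P {A a} → VanishesBelow P A a → NonzeroAt P A a → NonzeroAt Q B b →
                   NonzeroAt (P *ᵖ Q) (A ℤ.+ B) (a ℕ.+ b)
    nonzeroAt-*ᵖ [] {A} {a} _ nz _ = ⊥-elim (nz (coeffAt-zeroˢ (A ℤ.- + a ℤ.* W)))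
    nonzeroAt-*ᵖ (p ∷ P) {A} {zero} vb nz nzQ =
      nonzero-resp (≈-sym (coeffAt-+ᵖ (p ·ᵖ Q) (zeroˢ ∷ (P *ᵖ Q)) b x)) (nonzero-+ʳ
        (nonzeroAt-·ᵖ p Q (vanishesBelow-head p P vb)
          (subst (λ z → Nonzero (coeffAt p z)) (A-0W≡A W A) nz) vbQ nzQ)
        (vanishesBelow-shifted-*ᵖ p P vb b x (inj₂ (weight-position (A ℤ.+ B) b , ℕP.n<1+n b))))
      where
      x = (A ℤ.+ B) ℤ.- + b ℤ.* W
      A-0W≡A : ∀ W A → A ℤ.- + 0 ℤ.* W ≡ A
      A-0W≡A = solve-∀
    nonzeroAt-*ᵖ (p ∷ P) {A} {suc a} vb nz nzQ =
      nonzero-resp (≈-sym (coeffAt-+ᵖ (p ·ᵖ Q) (zeroˢ ∷ (P *ᵖ Q)) (suc (a ℕ.+ b)) x)) (nonzero-+ˡ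
        (vanishesBelow-·ᵖ p Q (vanishesBelow-head-suc p P vb) vbQ (suc (a ℕ.+ b)) x
          (inj₁ (subst (ℤ._< _) (sym (weight-position (A ℤ.+ B) (suc (a ℕ.+ b))))
                       (ℤP.+-monoˡ-< B (<-suc A)))))
        (subst (λ z → Nonzero (coeffAt (pcoeff (P *ᵖ Q) (a ℕ.+ b)) z))
               ([A-W+B]-kW≡[A+B]-[1+k]W W A B (+ (a ℕ.+ b)))
          (nonzeroAt-*ᵖ P (vanishesBelow-tail p P vb)
            (subst (λ z → Nonzero (coeffAt (pcoeff P a) z)) (A-[1+k]W≡[A-W]-kW W A (+ a)) nz) nzQ)))
      where
      x = (A ℤ.+ B) ℤ.- + suc (a ℕ.+ b) ℤ.* W
      A-[1+k]W≡[A-W]-kW : ∀ W A k → A ℤ.- (+ 1 ℤ.+ k) ℤ.* W ≡ (A ℤ.- W) ℤ.- k ℤ.* W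
      A-[1+k]W≡[A-W]-kW = solve-∀
      [A-W+B]-kW≡[A+B]-[1+k]W : ∀ W A B k →
        ((A ℤ.- W) ℤ.+ B) ℤ.- k ℤ.* W ≡ (A ℤ.+ B) ℤ.- (+ 1 ℤ.+ k) ℤ.* W
      [A-W+B]-kW≡[A+B]-[1+k]W = solve-∀

  initialTerm-*ᵖ : ∀ P Q {A a B b} → InitialTerm P A a → InitialTerm Q B b →
                   InitialTerm (P *ᵖ Q) (A ℤ.+ B) (a ℕ.+ b)
  initialTerm-*ᵖ P Q (vbP , nzP) (vbQ , nzQ) =
    vanishesBelow-*ᵖ Q vbQ P vbP , nonzeroAt-*ᵖ Q vbQ P vbP nzP nzQ

  initialTerm-·ᵖ : ∀ s Q {m B b} → OrderAtLeast s m → Nonzero (coeffAt s m) → InitialTerm Q B b →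
                   InitialTerm (s ·ᵖ Q) (m ℤ.+ B) b
  initialTerm-·ᵖ s Q oa nz (vb , nzQ) = vanishesBelow-·ᵖ s Q oa vb , nonzeroAt-·ᵖ s Q oa nz vb nzQ

  weight₁<W⇒negative : ∀ x → weight x 1 ℤ.< W → x ℤ.< + 0
  weight₁<W⇒negative x lt = +-cancelˡ-< W (subst₂ ℤ._<_ W+x (sym (ℤP.+-identityʳ W)) lt)
    where
    W+x : weight x 1 ≡ W ℤ.+ x
    W+x = trans (weight-suc x 0) (cong (λ w → W ℤ.+ w) (weight-zero x))

  initialTerm-Y- : ∀ y → Nonzero (coeffAt y (ord y)) → ∃ (InitialTerm (Y- y) (ord y ℤ.⊓ W))
  initialTerm-Y- y lead with ord y ℤP.≤? W
  ... | yes v≤W rewrite ℤP.i≤j⇒i⊓j≡i v≤W = 0 , vb , nz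
    where
    vb : VanishesBelow (Y- y) (ord y) 0
    vb zero          x (inj₁ lt) =
      ≈0⇒weaklyZero (reflexive (coeffAt-<ord (-ˢ y) (subst (ℤ._< ord y) (weight-zero x) lt)))
    vb (suc zero)    x (inj₁ lt) = ≈0⇒weaklyZero
      (coeffAt-oneˢ (ℤP.<⇒≢ (weight₁<W⇒negative x (ℤP.<-≤-trans lt v≤W))))
    vb (suc (suc j)) x _         = ≈0⇒weaklyZero (coeffAt-zeroˢ x)
    nz : NonzeroAt (Y- y) (ord y) 0
    nz = nonzero-resp (≈-sym (coeffAt--ˢ y (ord y ℤ.- + 0 ℤ.* W)))
      (nonzero-neg (subst (λ z → Nonzero (coeffAt y z)) (sym (v-0W≡v (ord y) W)) lead))
      where
      v-0W≡v : ∀ v W → v ℤ.- + 0 ℤ.* W ≡ v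
      v-0W≡v = solve-∀
  ... | no v≰W rewrite ℤP.i≥j⇒i⊓j≡j (ℤP.<⇒≤ (ℤP.≰⇒> v≰W)) = 1 , vb , nz
    where
    vb : VanishesBelow (Y- y) W 1
    vb zero          x lt        =
      ≈0⇒weaklyZero (reflexive (coeffAt-<ord (-ˢ y) (ℤP.≤-<-trans (below lt) (ℤP.≰⇒> v≰W))))
      where
      below : ∀ {k} → (weight x 0 , 0) ≺ (W , k) → x ℤ.≤ W
      below (inj₁ lt′)      = ℤP.<⇒≤ (subst (ℤ._< W) (weight-zero x) lt′)
      below (inj₂ (eq , _))  = ℤP.≤-reflexive (trans (sym (weight-zero x)) eq)
    vb (suc zero)    x (inj₁ lt) = ≈0⇒weaklyZero (coeffAt-oneˢ (ℤP.<⇒≢ (weight₁<W⇒negative x lt)))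
    vb (suc zero)    x (inj₂ (_ , ℕ.s≤s ()))
    vb (suc (suc j)) x _         = ≈0⇒weaklyZero (coeffAt-zeroˢ x)
    nz : NonzeroAt (Y- y) W 1
    nz = subst (λ z → Nonzero (coeffAt oneˢ z)) (sym (W-1W≡0 W)) nonzero-1
      where
      W-1W≡0 : ∀ W → W ℤ.- + 1 ℤ.* W ≡ + 0
      W-1W≡0 = solve-∀

  initialTerm-prodFin : ∀ n (G : Fin n → Poly) (C : Fin n → ℤ) → (∀ i → ∃ (InitialTerm (G i) (C i))) →
                        ∃ (InitialTerm (prodFin n G) (sum C))
  initialTerm-prodFin zero G C _ = 0 , vb , nz
    where
    vb : VanishesBelow (oneˢ ∷ []) (+ 0) 0
    vb zero    x (inj₁ lt) = ≈0⇒weaklyZero (coeffAt-oneˢ (ℤP.<⇒≢ (subst (ℤ._< + 0) (weight-zero x) lt)))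
    vb (suc j) x _         = ≈0⇒weaklyZero (coeffAt-zeroˢ x)
    nz : NonzeroAt (oneˢ ∷ []) (+ 0) 0
    nz = subst (λ z → Nonzero (coeffAt oneˢ z)) (sym (0-0W≡0 W)) nonzero-1
      where
      0-0W≡0 : ∀ W → + 0 ℤ.- + 0 ℤ.* W ≡ + 0
      0-0W≡0 = solve-∀
  initialTerm-prodFin (suc n) G C terms with terms Fin.zero
  ... | c , t with initialTerm-prodFin n (λ i → G (Fin.suc i)) (λ i → C (Fin.suc i)) (λ i → terms (Fin.suc i))
  ... | c′ , t′ = c ℕ.+ c′ , initialTerm-*ᵖ (G Fin.zero) (prodFin n (λ i → G (Fin.suc i))) t t′

  initialTerm⇒hasOrder : ∀ P {C c} → InitialTerm P C c → HasOrder P C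
  initialTerm⇒hasOrder P {c = c} (vb , nz) = vanishesBelow-≤index P ℕ.z≤n vb , c , nz

  hasOrder-resp : ∀ {P Q C} → P ≈ᵖ Q → HasOrder P C → HasOrder Q C
  hasOrder-resp {C = C} P≈Q (vb , j , nz) =
    (λ j x lt → weaklyZero-resp (P≈Q j x) (vb j x lt)) , j , nonzero-resp (P≈Q j (C ℤ.- + j ℤ.* W)) nz

  hasOrder-unique : ∀ {P C D} → HasOrder P C → HasOrder P D → C ≡ D
  hasOrder-unique {P} {C} {D} (vbC , j , nzC) (vbD , k , nzD) with ℤP.<-cmp C D
  ... | tri< C<D _ _ =
    ⊥-elim (vbD j (C ℤ.- + j ℤ.* W) (inj₁ (subst (ℤ._< D) (sym (weight-position C j)) C<D)) nzC)
  ... | tri≈ _ C≡D _ = C≡D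
  ... | tri> _ _ D<C =
    ⊥-elim (vbC k (D ℤ.- + k ℤ.* W) (inj₁ (subst (ℤ._< C) (sym (weight-position D k)) D<C)) nzD)

  hasOrder-factorisation : ∀ s {m} n (y : Fin n → LS) → OrderAtLeast s m → Nonzero (coeffAt s m) →
    (∀ i → Nonzero (coeffAt (y i) (ord (y i)))) →
    HasOrder (s ·ᵖ prodFin n (λ i → Y- y i)) (m ℤ.+ sum (λ i → ord (y i) ℤ.⊓ W))
  hasOrder-factorisation s n y oa nz lead
    with initialTerm-prodFin n (λ i → Y- y i) (λ i → ord (y i) ℤ.⊓ W) (λ i → initialTerm-Y- (y i) (lead i))
  ... | _ , t = initialTerm⇒hasOrder (s ·ᵖ ∏Y) (initialTerm-·ᵖ s ∏Y oa nz t)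
    where ∏Y = prodFin n (λ i → Y- y i)

module Derivatives {a ℓa} (K : Field a ℓa) where
  open Field K hiding (zero)
    renaming (refl to ≈-refl; sym to ≈-sym; trans to ≈-trans)
  open RingStuff commutativeRing
  open FieldVanishing K
  open import Algebra.Properties.Monoid.Mult +-monoid using (×-congʳ; ×-assocˡ; ×-homo-1)
    renaming (_×_ to _×ₙ_)
  open import Algebra.Properties.Semiring.Mult semiring using (×-assoc-*)

  ·ₙ≡×ₙ : ∀ m x → m ·ₙ x ≡ m ×ₙ x
  ·ₙ≡×ₙ zero    x = refl
  ·ₙ≡×ₙ (suc m) x = cong (λ z → x + z) (·ₙ≡×ₙ m x)

  iter-∂Y : ∀ j (G : ℕ → ℕ → Carrier) x y → ∃ λ m → iter K j (∂Y K) G x y ≈ suc m ×ₙ G x (y ℕ.+ j)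
  iter-∂Y zero    G x y = 0 , ≈-sym (≈-trans (×-homo-1 _) (reflexive (cong (G x) (ℕP.+-identityʳ y))))
  iter-∂Y (suc j) G x y with iter-∂Y j G x (suc y)
  ... | m , eq = m ℕ.+ y ℕ.* suc m , (begin
    suc y ·ₙ iter K j (∂Y K) G x (suc y)   ≡⟨ ·ₙ≡×ₙ (suc y) _ ⟩
    suc y ×ₙ iter K j (∂Y K) G x (suc y)   ≈⟨ ×-congʳ (suc y) eq ⟩
    suc y ×ₙ (suc m ×ₙ G x (suc y ℕ.+ j))  ≈⟨ ×-assocˡ _ (suc y) (suc m) ⟩
    (suc y ℕ.* suc m) ×ₙ G x (suc y ℕ.+ j) ≡⟨ cong (λ k → (suc y ℕ.* suc m) ×ₙ G x k) (sym (ℕP.+-suc y j)) ⟩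
    (suc y ℕ.* suc m) ×ₙ G x (y ℕ.+ suc j) ∎)
    where open ≈-Reasoning setoid

  iter-∂X : ∀ i (G : ℕ → ℕ → Carrier) x y → ∃ λ m → iter K i (∂X K) G x y ≈ suc m ×ₙ G (x ℕ.+ i) y
  iter-∂X zero    G x y = 0 , ≈-sym (≈-trans (×-homo-1 _) (reflexive (cong (λ k → G k y) (ℕP.+-identityʳ x))))
  iter-∂X (suc i) G x y with iter-∂X i G (suc x) y
  ... | m , eq = m ℕ.+ x ℕ.* suc m , (begin
    suc x ·ₙ iter K i (∂X K) G (suc x) y   ≡⟨ ·ₙ≡×ₙ (suc x) _ ⟩
    suc x ×ₙ iter K i (∂X K) G (suc x) y   ≈⟨ ×-congʳ (suc x) eq ⟩
    suc x ×ₙ (suc m ×ₙ G (suc x ℕ.+ i) y)  ≈⟨ ×-assocˡ _ (suc x) (suc m) ⟩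
    (suc x ℕ.* suc m) ×ₙ G (suc x ℕ.+ i) y ≡⟨ cong (λ k → (suc x ℕ.* suc m) ×ₙ G k y) (sym (ℕP.+-suc x i)) ⟩
    (suc x ℕ.* suc m) ×ₙ G (x ℕ.+ suc i) y ∎)
    where open ≈-Reasoning setoid

  -- the multiple is i! j!
  derivAt00≈multiple : ∀ n f i j → ∃ λ m → derivAt00 K n f i j ≈ (suc m ×ₙ 1#) * Fcoef K n f i j
  derivAt00≈multiple n f i j
    with iter-∂X i (iter K j (∂Y K) (Fcoef K n f)) 0 0 | iter-∂Y j (Fcoef K n f) i 0
  ... | m , ∂X≈ | m′ , ∂Y≈ = m′ ℕ.+ m ℕ.* suc m′ , (begin
    derivAt00 K n f i j                          ≈⟨ ∂X≈ ⟩
    suc m ×ₙ iter K j (∂Y K) (Fcoef K n f) i 0   ≈⟨ ×-congʳ (suc m) ∂Y≈ ⟩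
    suc m ×ₙ (suc m′ ×ₙ Fcoef K n f i j)         ≈⟨ ×-assocˡ _ (suc m) (suc m′) ⟩
    mm′ ×ₙ Fcoef K n f i j                       ≈⟨ ×-congʳ mm′ (≈-sym (*-identityˡ _)) ⟩
    mm′ ×ₙ (1# * Fcoef K n f i j)                ≈⟨ ≈-sym (×-assoc-* mm′ 1# _) ⟩
    (mm′ ×ₙ 1#) * Fcoef K n f i j                ∎)
    where
    open ≈-Reasoning setoid
    mm′ = suc m ℕ.* suc m′

  derivAt00-nonzero⇒ : ∀ n f i j → Nonzero (derivAt00 K n f i j) → Nonzero (Fcoef K n f i j)
  derivAt00-nonzero⇒ n f i j d≉0 F≈0 with derivAt00≈multiple n f i j
  ... | m , d≈ = d≉0 (≈-trans d≈ (≈-trans (*-congˡ F≈0) (zeroʳ _)))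

  nonzero⇒derivAt00-nonzero : CharZero K → ∀ n f i j →
                              Nonzero (Fcoef K n f i j) → Nonzero (derivAt00 K n f i j)
  nonzero⇒derivAt00-nonzero char0 n f i j F≉0 with derivAt00≈multiple n f i j
  ... | m , d≈ = nonzero-resp (≈-sym d≈) (nonzero-* (subst Nonzero (·ₙ≡×ₙ (suc m) 1#) (char0 m)) F≉0)

module FieldHomomorphism {a ℓa b ℓb} (K : Field a ℓa) (L : Field b ℓb)
                         {φ : Field.Carrier K → Field.Carrier L} (hom : IsFieldHom K L φ) where
  private
    module K = Field K
    module L = Field L
    module VK = FieldVanishing K
    module VL = FieldVanishing L
  open IsRingHomomorphism hom

  φ-weaklyZero : ∀ {x} → VK.WeaklyZero x → VL.WeaklyZero (φ x)
  φ-weaklyZero wx φx≉0 = wx (λ x≈0 → φx≉0 (L.trans (⟦⟧-cong x≈0) 0#-homo))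

  φ-nonzero : ∀ {x} → VK.Nonzero x → VL.Nonzero (φ x)
  φ-nonzero {x} x≉0 φx≈0 with K.inverse x x≉0
  ... | x⁻¹ , xx⁻¹≈1 = L.0≉1 (L.trans (L.sym (L.trans (L.*-congʳ φx≈0) (L.zeroˡ (φ x⁻¹))))
                               (L.trans (L.sym (*-homo x x⁻¹)) (L.trans (⟦⟧-cong xx⁻¹≈1) 1#-homo)))

module Lifting {a ℓa b ℓb} (K : Field a ℓa) (L : Field b ℓb) {φ : Field.Carrier K → Field.Carrier L}
               (hom : IsFieldHom K L φ) (E : ℕ) {{_ : NonZero E}} where
  private
    module K = Field K
    module VK = FieldVanishing K
    module RK = RingStuff K.commutativeRing
  open Field L hiding (zero)
    renaming (refl to ≈-refl; sym to ≈-sym; trans to ≈-trans)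
  open RingStuff commutativeRing
  open FieldVanishing L
  open FieldHomomorphism K L hom

  coeffAt-liftX-* : ∀ p q → coeffAt (liftX K L E φ p) (+ (q ℕ.* E)) ≡ φ (RK.coeffList p q)
  coeffAt-liftX-* p q = trans (coeffAt-ord+ (liftX K L E φ p) (q ℕ.* E) refl) (spread-* E _ q)

  liftX-weaklyZero : ∀ p x → (∀ q → x ≡ + (q ℕ.* E) → VK.WeaklyZero (RK.coeffList p q)) →
                     WeaklyZero (coeffAt (liftX K L E φ p) x)
  liftX-weaklyZero p x wp with ≥-view x (+ 0)
  ... | inj₁ x<0        = ≈0⇒weaklyZero (reflexive (coeffAt-<ord (liftX K L E φ p) x<0))
  ... | inj₂ (k , refl) = subst WeaklyZero (sym (coeffAt-ord+ (liftX K L E φ p) k refl))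
    (spread-weaklyZero E _ k (λ q k≡qE → φ-weaklyZero (wp q (cong +_ k≡qE))))

  pcoeff-FasPolyY-< : ∀ m g j (j<1+m : j ℕ.< suc m) →
                      pcoeff (FasPolyY K L E φ m g) j ≡ liftX K L E φ (g (Fin.fromℕ< j<1+m))
  pcoeff-FasPolyY-< zero    g zero    (ℕ.s≤s ℕ.z≤n) = refl
  pcoeff-FasPolyY-< (suc m) g zero    _             = refl
  pcoeff-FasPolyY-< (suc m) g (suc j) (ℕ.s≤s j<1+m) = pcoeff-FasPolyY-< m (λ i → g (Fin.suc i)) j j<1+m

  pcoeff-FasPolyY-≥ : ∀ m g j → suc m ℕ.≤ j → pcoeff (FasPolyY K L E φ m g) j ≡ zeroˢ
  pcoeff-FasPolyY-≥ zero    g (suc j) _             = refl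
  pcoeff-FasPolyY-≥ (suc m) g (suc j) (ℕ.s≤s 1+m≤j) = pcoeff-FasPolyY-≥ m (λ i → g (Fin.suc i)) j 1+m≤j

  -- abstracting over j <? suc n also unfolds Fcoef K n f i j
  coeffAt-F-* : ∀ n f i j → coeffAt (pcoeff (FasPolyY K L E φ n f) j) (+ (i ℕ.* E)) ≈ φ (Fcoef K n f i j)
  coeffAt-F-* n f i j with j ℕ.<? suc n
  ... | yes j<1+n rewrite pcoeff-FasPolyY-< n f j j<1+n =
    reflexive (coeffAt-liftX-* (f (Fin.fromℕ< j<1+n)) i)
  ... | no j≮1+n rewrite pcoeff-FasPolyY-≥ n f j (ℕP.≮⇒≥ j≮1+n) =
    ≈-trans (coeffAt-zeroˢ (+ (i ℕ.* E))) (≈-sym (IsRingHomomorphism.0#-homo hom))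

  coeffAt-F-weaklyZero : ∀ n f j x → (∀ i → x ≡ + (i ℕ.* E) → VK.WeaklyZero (Fcoef K n f i j)) →
                         WeaklyZero (coeffAt (pcoeff (FasPolyY K L E φ n f) j) x)
  coeffAt-F-weaklyZero n f j x wF with j ℕ.<? suc n
  ... | yes j<1+n rewrite pcoeff-FasPolyY-< n f j j<1+n =
    liftX-weaklyZero (f (Fin.fromℕ< j<1+n)) x wF
  ... | no j≮1+n rewrite pcoeff-FasPolyY-≥ n f j (ℕP.≮⇒≥ j≮1+n) = ≈0⇒weaklyZero (coeffAt-zeroˢ x)

fraction-≡ : ∀ a d a′ d′ .{{_ : NonZero d}} .{{_ : NonZero d′}} →
             a ℤ.* + d′ ≡ a′ ℤ.* + d → a / d ≡ a′ / d′
fraction-≡ a (suc d) a′ (suc d′) eq =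
  ℚP.fromℚᵘ-cong {ℚᵘ.mkℚᵘ a d} {ℚᵘ.mkℚᵘ a′ d′} (ℚᵘ.*≡* eq)

fraction-≤ : ∀ a d a′ d′ .{{_ : NonZero d}} .{{_ : NonZero d′}} →
             a ℤ.* + d′ ℤ.≤ a′ ℤ.* + d → a / d ℚ.≤ a′ / d′
fraction-≤ a (suc d) a′ (suc d′) le = ℚP.toℚᵘ-cancel-≤
  (ℚᵘP.≤-respʳ-≃ (ℚᵘP.≃-sym (ℚP.toℚᵘ-fromℚᵘ (ℚᵘ.mkℚᵘ a′ d′)))
    (ℚᵘP.≤-respˡ-≃ (ℚᵘP.≃-sym (ℚP.toℚᵘ-fromℚᵘ (ℚᵘ.mkℚᵘ a d))) (ℚᵘ.*≤* le)))

/-distrib-+ : ∀ a b d .{{_ : NonZero d}} → (a ℤ.+ b) / d ≡ a / d ℚ.+ b / d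
/-distrib-+ a b (suc d) = ℚP.toℚᵘ-injective (ℚᵘP.≃-sym
  (ℚᵘP.≃-trans (ℚP.toℚᵘ-homo-+ (a / suc d) (b / suc d))
  (ℚᵘP.≃-trans (ℚᵘP.+-cong (ℚP.toℚᵘ-fromℚᵘ (ℚᵘ.mkℚᵘ a d))
                            (ℚP.toℚᵘ-fromℚᵘ (ℚᵘ.mkℚᵘ b d)))
  (ℚᵘP.≃-trans (ℚᵘ.*≡* cross) (ℚᵘP.≃-sym (ℚP.toℚᵘ-fromℚᵘ (ℚᵘ.mkℚᵘ (a ℤ.+ b) d)))))))
  where
  [aD+bD]D≡[a+b][DD] : ∀ a b D → (a ℤ.* D ℤ.+ b ℤ.* D) ℤ.* D ≡ (a ℤ.+ b) ℤ.* (D ℤ.* D)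
  [aD+bD]D≡[a+b][DD] = solve-∀
  cross : (a ℤ.* + suc d ℤ.+ b ℤ.* + suc d) ℤ.* + suc d ≡ (a ℤ.+ b) ℤ.* + (suc d ℕ.* suc d)
  cross = trans ([aD+bD]D≡[a+b][DD] a b (+ suc d))
                (cong (λ D → (a ℤ.+ b) ℤ.* D) (sym (ℤP.pos-* (suc d) (suc d))))

sumℚ-/ : ∀ n (a : Fin n → ℤ) d .{{_ : NonZero d}} → sumℚ n (λ i → a i / d) ≡ sum a / d
sumℚ-/ zero    a d = sym (ℚP.0/n≡0 d)
sumℚ-/ (suc n) a d = trans (cong (a Fin.zero / d ℚ.+_) (sumℚ-/ n (λ i → a (Fin.suc i)) d))
                           (sym (/-distrib-+ (a Fin.zero) (sum (λ i → a (Fin.suc i))) d))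

sumℚ-cong : ∀ n {g h : Fin n → ℚ} → (∀ i → g i ≡ h i) → sumℚ n g ≡ sumℚ n h
sumℚ-cong zero    g≗h = refl
sumℚ-cong (suc n) g≗h = cong₂ ℚ._+_ (g≗h Fin.zero) (sumℚ-cong n (λ i → g≗h (Fin.suc i)))

sum-distrib-- : ∀ n (a b : Fin n → ℤ) → sum (λ i → a i ℤ.- b i) ≡ sum a ℤ.- sum b
sum-distrib-- zero    a b = refl
sum-distrib-- (suc n) a b =
  trans (cong (λ s → (a Fin.zero ℤ.- b Fin.zero) ℤ.+ s)
              (sum-distrib-- n (λ i → a (Fin.suc i)) (λ i → b (Fin.suc i))))
        ([a-b]+[A-B]≡[a+A]-[b+B] (a Fin.zero) (b Fin.zero) _ _)
  where
  [a-b]+[A-B]≡[a+A]-[b+B] : ∀ a b A B → (a ℤ.- b) ℤ.+ (A ℤ.- B) ≡ (a ℤ.+ A) ℤ.- (b ℤ.+ B)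
  [a-b]+[A-B]≡[a+A]-[b+B] = solve-∀

termD-fraction : ∀ κ e .{{_ : NonZero e}} → termD κ e (+ 0 ℤP.<? κ) ≡ (κ ℤ.⊓ + e ℤ.- κ ℤ.⊓ + 0) / e
termD-fraction κ e with + 0 ℤP.<? κ
... | no 0≮κ
  rewrite ℤP.i≤j⇒i⊓j≡i (ℤP.≤-trans (ℤP.≮⇒≥ 0≮κ) (ℤ.+≤+ (ℕ.z≤n {e})))
        | ℤP.i≤j⇒i⊓j≡i (ℤP.≮⇒≥ 0≮κ) | ℤP.+-inverseʳ κ = sym (ℚP.0/n≡0 e)
... | yes 0<κ rewrite ℤP.i≥j⇒i⊓j≡j (ℤP.<⇒≤ 0<κ) | ℤP.+-identityʳ (κ ℤ.⊓ + e) with κ ℤP.≤? + e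
...   | yes κ≤e rewrite ℤP.i≤j⇒i⊓j≡i κ≤e = ℚP.p≥q⇒p⊓q≡q
  (fraction-≤ κ e (+ 1) 1 (subst₂ ℤ._≤_ (sym (ℤP.*-identityʳ κ)) (sym (ℤP.*-identityˡ (+ e))) κ≤e))
...   | no κ≰e rewrite ℤP.i≥j⇒i⊓j≡j (ℤP.<⇒≤ (ℤP.≰⇒> κ≰e)) =
  trans (ℚP.p≤q⇒p⊓q≡p (fraction-≤ (+ 1) 1 κ e (subst₂ ℤ._≤_
          (sym (ℤP.*-identityˡ (+ e))) (sym (ℤP.*-identityʳ κ)) (ℤP.<⇒≤ (ℤP.≰⇒> κ≰e)))))
        (fraction-≡ (+ 1) 1 (+ e) e (trans (ℤP.*-identityˡ (+ e)) (sym (ℤP.*-identityʳ (+ e)))))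

termD-scaled : ∀ κ e m E .{{_ : NonZero e}} .{{_ : NonZero E}} → E ≡ m ℕ.* e →
  termD κ e (+ 0 ℤP.<? κ) ≡ ((κ ℤ.* + m) ℤ.⊓ + E ℤ.- (κ ℤ.* + m) ℤ.⊓ + 0) / E
termD-scaled κ e m E E≡me = begin
  termD κ e (+ 0 ℤP.<? κ)  ≡⟨ termD-fraction κ e ⟩
  a / e                    ≡⟨ fraction-≡ a e (a ℤ.* + m) E a*E≡a*m*e ⟩
  (a ℤ.* + m) / E          ≡⟨ cong (_/ E) scaled ⟨
  ((κ ℤ.* + m) ℤ.⊓ + E ℤ.- (κ ℤ.* + m) ℤ.⊓ + 0) / E ∎
  where
  open ≡-Reasoning
  a = κ ℤ.⊓ + e ℤ.- κ ℤ.⊓ + 0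
  +E≡+m*+e : + E ≡ + m ℤ.* + e
  +E≡+m*+e = trans (cong +_ E≡me) (ℤP.pos-* m e)
  a*E≡a*m*e : a ℤ.* + E ≡ (a ℤ.* + m) ℤ.* + e
  a*E≡a*m*e = trans (cong (a ℤ.*_) +E≡+m*+e) (sym (ℤP.*-assoc a (+ m) (+ e)))
  scale : ∀ x → (κ ℤ.⊓ x) ℤ.* + m ≡ (κ ℤ.* + m) ℤ.⊓ (x ℤ.* + m)
  scale = ℤP.mono-≤-distrib-⊓ (ℤP.*-monoʳ-≤-nonNeg (+ m)) κ
  u*m-v*m≡[u-v]*m : ∀ u v m → u ℤ.* m ℤ.- v ℤ.* m ≡ (u ℤ.- v) ℤ.* m
  u*m-v*m≡[u-v]*m = solve-∀
  scaled : (κ ℤ.* + m) ℤ.⊓ + E ℤ.- (κ ℤ.* + m) ℤ.⊓ + 0 ≡ a ℤ.* + m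
  scaled = begin
    (κ ℤ.* + m) ℤ.⊓ + E ℤ.- (κ ℤ.* + m) ℤ.⊓ + 0
      ≡⟨ cong (λ x → (κ ℤ.* + m) ℤ.⊓ x ℤ.- (κ ℤ.* + m) ℤ.⊓ (+ 0 ℤ.* + m))
              (trans +E≡+m*+e (ℤP.*-comm (+ m) (+ e))) ⟩
    (κ ℤ.* + m) ℤ.⊓ (+ e ℤ.* + m) ℤ.- (κ ℤ.* + m) ℤ.⊓ (+ 0 ℤ.* + m)
      ≡⟨ cong₂ ℤ._-_ (scale (+ e)) (scale (+ 0)) ⟨
    (κ ℤ.⊓ + e) ℤ.* + m ℤ.- (κ ℤ.⊓ + 0) ℤ.* + m
      ≡⟨ u*m-v*m≡[u-v]*m (κ ℤ.⊓ + e) (κ ℤ.⊓ + 0) (+ m) ⟩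
    a ℤ.* + m ∎

puiseuxSum-from-orders : ∀ n e (epos : ∀ i → NonZero (e i)) κ E .{{_ : NonZero E}} (m : Fin n → ℕ) →
  (∀ i → E ≡ m i ℕ.* e i) → ∀ c r →
  c ℤ.+ sum (λ i → (κ i ℤ.* + m i) ℤ.⊓ + E) ≡ + E ℤ.* + r →
  c ℤ.+ sum (λ i → (κ i ℤ.* + m i) ℤ.⊓ + 0) ≡ + 0 →
  + r / 1 ≡ puiseuxSum n e epos κ
puiseuxSum-from-orders n e epos κ E m E≡me c r order-E order-0 = begin
  + r / 1                                            ≡⟨ fraction-≡ (+ r) 1 (+ E ℤ.* + r) E r*E≡E*r*1 ⟩
  (+ E ℤ.* + r) / E                                  ≡⟨ cong (_/ E) difference ⟩
  (sum (term (+ E)) ℤ.- sum (term (+ 0))) / E        ≡⟨ cong (_/ E) (sum-distrib-- n (term (+ E)) (term (+ 0))) ⟨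
  sum (λ i → term (+ E) i ℤ.- term (+ 0) i) / E      ≡⟨ sumℚ-/ n _ E ⟨
  sumℚ n (λ i → (term (+ E) i ℤ.- term (+ 0) i) / E) ≡⟨ sumℚ-cong n termD≡ ⟨
  puiseuxSum n e epos κ                              ∎
  where
  open ≡-Reasoning
  term : ℤ → Fin n → ℤ
  term W i = (κ i ℤ.* + m i) ℤ.⊓ W
  termD≡ : ∀ i → termD (κ i) (e i) {{epos i}} (+ 0 ℤP.<? κ i) ≡ (term (+ E) i ℤ.- term (+ 0) i) / E
  termD≡ i = termD-scaled (κ i) (e i) (m i) E {{epos i}} (E≡me i)
  r*E≡E*r*1 : + r ℤ.* + E ≡ (+ E ℤ.* + r) ℤ.* + 1
  r*E≡E*r*1 = trans (ℤP.*-comm (+ r) (+ E)) (sym (ℤP.*-identityʳ (+ E ℤ.* + r)))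
  [c+A]-[c+B]≡A-B : ∀ c A B → (c ℤ.+ A) ℤ.- (c ℤ.+ B) ≡ A ℤ.- B
  [c+A]-[c+B]≡A-B = solve-∀
  difference : + E ℤ.* + r ≡ sum (term (+ E)) ℤ.- sum (term (+ 0))
  difference = begin
    + E ℤ.* + r                                           ≡⟨ ℤP.+-identityʳ (+ E ℤ.* + r) ⟨
    + E ℤ.* + r ℤ.- + 0                                   ≡⟨ cong₂ ℤ._-_ order-E order-0 ⟨
    (c ℤ.+ sum (term (+ E))) ℤ.- (c ℤ.+ sum (term (+ 0))) ≡⟨ [c+A]-[c+B]≡A-B c _ _ ⟩
    sum (term (+ E)) ℤ.- sum (term (+ 0))                 ∎

prodℕ-nonzero : ∀ {a ℓa b ℓb} (K : Field a ℓa) (L : Field b ℓb) m (g : Fin m → ℕ) →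
                (∀ i → NonZero (g i)) → NonZero (prodℕ K L m g)
prodℕ-nonzero K L ℕ.zero    g g≢0 = _
prodℕ-nonzero K L (suc m) g g≢0 = ℕP.m*n≢0 (g Fin.zero) _ {{g≢0 Fin.zero}}
  {{prodℕ-nonzero K L m (λ i → g (Fin.suc i)) (λ i → g≢0 (Fin.suc i))}}

∣prodℕ : ∀ {a ℓa b ℓb} (K : Field a ℓa) (L : Field b ℓb) m (g : Fin m → ℕ) i → g i ∣ prodℕ K L m g
∣prodℕ K L (suc m) g Fin.zero    = m∣m*n _
∣prodℕ K L (suc m) g (Fin.suc i) = ∣-trans (∣prodℕ K L m (λ i → g (Fin.suc i)) i) (n∣m*n (g Fin.zero))

module Proposition {a ℓa b ℓb} (K : Field a ℓa) (L : Field b ℓb) (char0 : CharZero K)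
  {φ : Field.Carrier K → Field.Carrier L} (hom : IsFieldHom K L φ)
  (n : ℕ) (f : Fin (suc n) → List (Field.Carrier K)) (F0Y : F0YNonzero K n f)
  (e : Fin n → ℕ) (epos : ∀ i → NonZero (e i)) (κ : Fin n → ℤ) (β : Fin n → ℕ → Field.Carrier L)
  (β-nonzero : ∀ i → ¬ (Field._≈_ L (β i 0) (Field.0# L)))
  (factors : FactorsAs K L φ n f e epos κ β)
  (r : ℕ) (r-min : IsMinDerivOrder K n f r)
  (d : ℕ) (d-least : FieldVanishing.IsLeastNonzero K
                       (RingStuff.coeffList (Field.commutativeRing K) (f (Fin.fromℕ n))) d)
  where
  open Field L hiding (zero)
    renaming (refl to ≈-refl; sym to ≈-sym; trans to ≈-trans)
  open RingStuff commutativeRing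
  open FieldVanishing L
  open FieldHomomorphism K L hom
  open Derivatives K

  E : ℕ
  E = prodℕ K L n e

  instance
    E-nonzero : NonZero E
    E-nonzero = prodℕ-nonzero K L n e epos

  open Lifting K L hom E

  m : Fin n → ℕ
  m i = (E ℕ./ e i) {{epos i}}

  E≡m*e : ∀ i → E ≡ m i ℕ.* e i
  E≡m*e i = sym (m/n*n≡m {{epos i}} (∣prodℕ K L n e i))

  y : Fin n → LS
  y i = puiseux K L E (e i) {{epos i}} (κ i) (β i)

  m-nonzero : ∀ i → NonZero (m i)
  m-nonzero i = ℕP.m*n≢0⇒m≢0 (m i) {e i} {{subst NonZero (E≡m*e i) E-nonzero}}

  leading-nonzero : ∀ i → Nonzero (coeffAt (y i) (ord (y i)))
  leading-nonzero i = subst Nonzero (sym leading) (β-nonzero i)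
    where
    leading : coeffAt (y i) (ord (y i)) ≡ β i 0
    leading = trans (coeffAt-ord+ (y i) 0 (sym (ℤP.+-identityʳ (ord (y i)))))
                    (spread-* (m i) {{m-nonzero i}} (β i) 0)

  fₙ : List (Field.Carrier K)
  fₙ = f (Fin.fromℕ n)

  liftX-fₙ-order : OrderAtLeast (liftX K L E φ fₙ) (+ (d ℕ.* E))
  liftX-fₙ-order x x<dE = liftX-weaklyZero fₙ x λ q x≡qE →
    proj₂ d-least q (ℕP.*-cancelʳ-< E q d (ℤP.drop‿+<+ (subst (ℤ._< + (d ℕ.* E)) x≡qE x<dE)))

  liftX-fₙ-nonzero : Nonzero (coeffAt (liftX K L E φ fₙ) (+ (d ℕ.* E)))
  liftX-fₙ-nonzero = subst Nonzero (sym (coeffAt-liftX-* fₙ d)) (φ-nonzero (proj₁ d-least))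

  Fₜ : Poly
  Fₜ = FasPolyY K L E φ n f

  order-factored : ∀ W → Weighted.HasOrder L W Fₜ (+ (d ℕ.* E) ℤ.+ sum (λ i → ord (y i) ℤ.⊓ W))
  order-factored W = hasOrder-resp {P = liftX K L E φ fₙ ·ᵖ prodFin n (λ i → Y- y i)} {Q = Fₜ}
    (λ j x → ≈-sym (factors j x))
    (hasOrder-factorisation (liftX K L E φ fₙ) n y liftX-fₙ-order liftX-fₙ-nonzero leading-nonzero)
    where open Weighted L W

  order-E : Weighted.HasOrder L (+ E) Fₜ (+ E ℤ.* + r)
  order-E = vanishing , attained
    where
    open Weighted L (+ E)
    monomial-weight : ∀ i j → weight (+ (i ℕ.* E)) j ≡ + ((i ℕ.+ j) ℕ.* E)
    monomial-weight i j = trans (cong (λ z → + (i ℕ.* E) ℤ.+ z) (sym (ℤP.pos-* j E)))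
      (trans (sym (ℤP.pos-+ (i ℕ.* E) (j ℕ.* E))) (cong +_ (sym (ℕP.*-distribʳ-+ E i j))))
    rE : + E ℤ.* + r ≡ + (r ℕ.* E)
    rE = trans (sym (ℤP.pos-* E r)) (cong +_ (ℕP.*-comm E r))
    vanishing : VanishesBelow Fₜ (+ E ℤ.* + r) 0
    vanishing j x (inj₁ lt) = coeffAt-F-weaklyZero n f j x λ { i refl F≉0 →
      ℕP.<⇒≱ (ℕP.*-cancelʳ-< E _ _ (ℤP.drop‿+<+ (subst₂ ℤ._<_ (monomial-weight i j) rE lt)))
             (proj₂ r-min i j (nonzero⇒derivAt00-nonzero char0 n f i j F≉0)) }
    attained : ∃ (NonzeroAt Fₜ (+ E ℤ.* + r))
    attained = let i , j , i+j≡r , ∂≉0 = proj₁ r-min in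
      j , subst (λ z → Nonzero (coeffAt (pcoeff Fₜ j) z)) (sym (position i j i+j≡r))
        (nonzero-resp (≈-sym (coeffAt-F-* n f i j)) (φ-nonzero (derivAt00-nonzero⇒ n f i j ∂≉0)))
      where
      position : ∀ i j → i ℕ.+ j ≡ r → + E ℤ.* + r ℤ.- + j ℤ.* + E ≡ + (i ℕ.* E)
      position i j refl = trans (cong (λ z → + E ℤ.* z ℤ.- + j ℤ.* + E) (ℤP.pos-+ i j))
                                (trans (E[i+j]-jE≡iE (+ E) (+ i) (+ j)) (sym (ℤP.pos-* i E)))
        where
        E[i+j]-jE≡iE : ∀ E i j → E ℤ.* (i ℤ.+ j) ℤ.- j ℤ.* E ≡ i ℤ.* E
        E[i+j]-jE≡iE = solve-∀

  order-0 : Weighted.HasOrder L (+ 0) Fₜ (+ 0)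
  order-0 = vanishing , attained
    where
    open Weighted L (+ 0)
    vanishing : VanishesBelow Fₜ (+ 0) 0
    vanishing j x (inj₁ lt) = coeffAt-F-weaklyZero n f j x λ { i refl →
      ⊥-elim (ℤP.<⇒≱ (subst (ℤ._< + 0) (x+j0≡x (+ (i ℕ.* E)) (+ j)) lt) (ℤ.+≤+ ℕ.z≤n)) }
      where
      x+j0≡x : ∀ x j → x ℤ.+ j ℤ.* + 0 ≡ x
      x+j0≡x = solve-∀
    position : ∀ j → + 0 ℤ.- j ℤ.* + 0 ≡ + 0
    position = solve-∀
    attained : ∃ (NonzeroAt Fₜ (+ 0))
    attained = let j , F≉0 = F0Y in
      j , subst (λ z → Nonzero (coeffAt (pcoeff Fₜ j) z)) (sym (position (+ j)))
            (nonzero-resp (≈-sym (coeffAt-F-* n f 0 j)) (φ-nonzero F≉0))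

  r≡puiseuxSum : + r / 1 ≡ puiseuxSum n e epos κ
  r≡puiseuxSum = puiseuxSum-from-orders n e epos κ E m E≡m*e (+ (d ℕ.* E)) r
    (Weighted.hasOrder-unique L (+ E) {P = Fₜ} (order-factored (+ E)) order-E)
    (Weighted.hasOrder-unique L (+ 0) {P = Fₜ} (order-factored (+ 0)) order-0)

proposition3p2 : ∀ {a ℓa b ℓb} (K : Field a ℓa) (L : Field b ℓb) → CharZero K →
    (φ : Field.Carrier K → Field.Carrier L) → IsFieldHom K L φ → FiniteOver K L φ →
    (n : ℕ) (f : Fin (suc n) → List (Field.Carrier K)) →
    YDegree K n f → F0YNonzero K n f →
    (e : Fin n → ℕ) (epos : ∀ i → NonZero (e i)) →
    (κ : Fin n → ℤ) (β : Fin n → ℕ → Field.Carrier L) →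
    (∀ i → ¬ (Field._≈_ L (β i 0) (Field.0# L))) →
    FactorsAs K L φ n f e epos κ β →
    (r : ℕ) → IsMinDerivOrder K n f r →
    (+ r / 1) ≡ puiseuxSum n e epos κ
proposition3p2 K L char0 φ hom _ n f (k , fₙ-k≉0) F0Y e epos κ β β-nonzero factors r r-min =
  decidable-stable (+ r / 1 ℚP.≟ puiseuxSum n e epos κ) λ r≢sum →
    FieldVanishing.¬¬least-nonzero K (RingStuff.coeffList (Field.commutativeRing K) (f (Fin.fromℕ n))) k fₙ-k≉0
      λ (d , d-least) → r≢sum
        (Proposition.r≡puiseuxSum K L char0 hom n f F0Y e epos κ β β-nonzero factors r r-min d d-least)
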